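{- The logic $\mathsf{CnK}$ is non-trivial and negation-inconsistent. Moreover, $\to$ is fully hyperconnexive in $\mathsf{CnK}$, and $\Rightarrow$ is fully connexive in $\mathsf{CnK}$ but neither plainly nor weakly hyperconnexive in $\mathsf{CnK}$.
   Context: $\mathsf{CnK}$: modal formulas are built from propositional letters with $\wedge,\vee,\to,\sim$ (strong negation), $\Box,\Diamond$. A modal Fischer-Servi model is $(W,\leq,R,V^+,V^-)$ with $W\neq\emptyset$, $\leq$ a preorder, $R\subseteq W\times W$, $V^\pm$ maps letters to $\leq$-upward closed subsets, satisfying (c1) $w\leq w'$, $wRv$ imply $w'Rv'$, $v\leq v'$ for some $v'$; (c2) $wRv$, $v\leq v'$ imply $w\leq w'$, $w'Rv'$ for some $w'$. Verification/falsification: $w\models^\pm p$ iff $w\in V^\pm(p)$; $\wedge$: $+$ iff both $+$, $-$ iff some $-$; $\vee$: $+$ iff some $+$, $-$ iff both $-$; $w\models^\pm\sim\psi$ iff $w\models^\mp\psi$; $w\models^+\psi\to\chi$ iff $\forall v\geq w(v\models^+\psi\Rightarrow v\models^+\chi)$; $w\models^-\psi\to\chi$ iff $\forall v\geq w(v\models^+\psi\Rightarrow v\models^-\chi)$; $w\models^\pm\Box\psi$ iff $\forall v\geq w\,\forall u(vRu\Rightarrow u\models^\pm\psi)$; $w\models^\pm\Diamond\psi$ iff $\exists u(wRu$ and $u\models^\pm\psi)$. $\Gamma\models_{\mathsf{CnK}}\Delta$ iff no world verifies ($\models^+$) all of $\Gamma$ and none of $\Delta$; $\phi\in\mathsf{CnK}$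 iff $\emptyset\models\{\phi\}$. $\phi\Rightarrow\psi$ abbreviates $(\phi\to\psi)\wedge(\sim\psi\to\sim\phi)$. Logical properties, for a logic $\mathsf{L}$ and a binary (possibly defined) connective $\ast$: $\mathsf{L}$ is trivial iff $\Gamma\models_\mathsf{L}\Delta$ for all $\Gamma,\Delta$; negation-inconsistent iff $\phi\wedge\sim\phi\in\mathsf{L}$ for some $\phi$. Schemes: (AT) $\sim(\sim\phi\ast\phi)$; (BT) $(\phi\ast\sim\psi)\ast\sim(\phi\ast\psi)$; (nonSym) $(\phi\ast\psi)\ast(\psi\ast\phi)$; (WBT) $\phi\ast\sim\psi\models_\mathsf{L}\sim(\phi\ast\psi)$; (WnonSym) $\phi\ast\psi\models_\mathsf{L}\psi\ast\phi$; (CBT) $\sim(\phi\ast\psi)\ast(\phi\ast\sim\psi)$; (WCBT) $\sim(\phi\ast\psi)\models_\mathsf{L}\phi\ast\sim\psi$. $\ast$ is plainly connexive iff all instances of AT and BT are valid and some instance of nonSym is not; weakly connexive iff all instances of AT and WBT hold and some instance of WnonSym fails; fully connexive iff both plainly and weakly connexive. Plainly hyperconnexive: plainly connexive and CBT valid; weakly hyperconnexive: weakly connexive and WCBT holds; fully hyperconnexive: both. -}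

module Defs where

open import Data.Nat using (ℕ)
open import Data.Product using (Σ; _×_; ∃-syntax)
open import Data.Sum using (_⊎_)
open import Data.Empty using (⊥)
open import Relation.Nullary using (¬_)
open import Relation.Binary.PropositionalEquality using (_≡_)

Atom : Set
Atom = ℕ

infixr 6 _∧_
infixr 5 _∨_
infixr 4 _⟶_

data Form : Set where
  var  : Atom → Form
  _∧_  : Form → Form → Form
  _∨_  : Form → Form → Form
  _⟶_  : Form → Form → Form
  ∼_   : Form → Form
  □_   : Form → Form
  ◇_   : Form → Form

_⇒_ : Form → Form → Form
φ ⇒ ψ = (φ ⟶ ψ) ∧ ((∼ ψ) ⟶ (∼ φ))

record Model : Set₁ where
  field
    W        : Set
    inhabited : W
    _≤_      : W → W → Set
    ≤-refl   : ∀ w → w ≤ w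
    ≤-trans  : ∀ {u v w} → u ≤ v → v ≤ w → u ≤ w
    R        : W → W → Set
    V⁺       : Atom → W → Set
    V⁻       : Atom → W → Set
    V⁺-up    : ∀ p {w v} → w ≤ v → V⁺ p w → V⁺ p v
    V⁻-up    : ∀ p {w v} → w ≤ v → V⁻ p w → V⁻ p v
    c1       : ∀ {w w′ v} → w ≤ w′ → R w v → Σ W (λ v′ → R w′ v′ × (v ≤ v′))
    c2       : ∀ {w v v′} → R w v → v ≤ v′ → Σ W (λ w′ → (w ≤ w′) × R w′ v′)

module _ (M : Model) where
  open Model M

  _⊨⁺_ : W → Form → Set
  _⊨⁻_ : W → Form → Set
  w ⊨⁺ var p   = V⁺ p w
  w ⊨⁺ (φ ∧ ψ) = (w ⊨⁺ φ) × (w ⊨⁺ ψ)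
  w ⊨⁺ (φ ∨ ψ) = (w ⊨⁺ φ) ⊎ (w ⊨⁺ ψ)
  w ⊨⁺ (φ ⟶ ψ) = ∀ v → w ≤ v → v ⊨⁺ φ → v ⊨⁺ ψ
  w ⊨⁺ (∼ φ)   = w ⊨⁻ φ
  w ⊨⁺ (□ φ)   = ∀ v → w ≤ v → ∀ u → R v u → u ⊨⁺ φ
  w ⊨⁺ (◇ φ)   = Σ W (λ u → R w u × (u ⊨⁺ φ))
  w ⊨⁻ var p   = V⁻ p w
  w ⊨⁻ (φ ∧ ψ) = (w ⊨⁻ φ) ⊎ (w ⊨⁻ ψ)
  w ⊨⁻ (φ ∨ ψ) = (w ⊨⁻ φ) × (w ⊨⁻ ψ)
  w ⊨⁻ (φ ⟶ ψ) = ∀ v → w ≤ v → v ⊨⁺ φ → v ⊨⁻ ψ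
  w ⊨⁻ (∼ φ)   = w ⊨⁺ φ
  w ⊨⁻ (□ φ)   = ∀ v → w ≤ v → ∀ u → R v u → u ⊨⁻ φ
  w ⊨⁻ (◇ φ)   = Σ W (λ u → R w u × (u ⊨⁻ φ))

FormSet : Set₁
FormSet = Form → Set

∅ : FormSet
∅ _ = ⊥

｛_｝ : Form → FormSet
｛ φ ｝ ψ = ψ ≡ φ

_⊨_ : FormSet → FormSet → Set₁
Γ ⊨ Δ = (M : Model) (w : Model.W M) →
  ¬ ((∀ φ → Γ φ → _⊨⁺_ M w φ) × (∀ ψ → Δ ψ → ¬ _⊨⁺_ M w ψ))

Valid : Form → Set₁
Valid φ = ∅ ⊨ ｛ φ ｝

Trivial : Set₁
Trivial = (Γ Δ : FormSet) → Γ ⊨ Δ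

NegInconsistent : Set₁
NegInconsistent = Σ Form (λ φ → Valid (φ ∧ (∼ φ)))

Conn : Set
Conn = Form → Form → Form

module _ (_⋆_ : Conn) where
  AT : Set₁
  AT = ∀ φ → Valid (∼ ((∼ φ) ⋆ φ))

  BT : Set₁
  BT = ∀ φ ψ → Valid ((φ ⋆ (∼ ψ)) ⋆ (∼ (φ ⋆ ψ)))

  NonSymFails : Set₁
  NonSymFails = Σ Form (λ φ → Σ Form (λ ψ → ¬ Valid ((φ ⋆ ψ) ⋆ (ψ ⋆ φ))))

  WBT : Set₁
  WBT = ∀ φ ψ → ｛ φ ⋆ (∼ ψ) ｝ ⊨ ｛ ∼ (φ ⋆ ψ) ｝

  WNonSymFails : Set₁
  WNonSymFails = Σ Form (λ φ → Σ Form (λ ψ → ¬ (｛ φ ⋆ ψ ｝ ⊨ ｛ ψ ⋆ φ ｝)))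

  CBT : Set₁
  CBT = ∀ φ ψ → Valid ((∼ (φ ⋆ ψ)) ⋆ (φ ⋆ (∼ ψ)))

  WCBT : Set₁
  WCBT = ∀ φ ψ → ｛ ∼ (φ ⋆ ψ) ｝ ⊨ ｛ φ ⋆ (∼ ψ) ｝

  PlainlyConnexive : Set₁
  PlainlyConnexive = AT × BT × NonSymFails

  WeaklyConnexive : Set₁
  WeaklyConnexive = AT × WBT × WNonSymFails

  FullyConnexive : Set₁
  FullyConnexive = PlainlyConnexive × WeaklyConnexive

  PlainlyHyperconnexive : Set₁
  PlainlyHyperconnexive = PlainlyConnexive × CBT

  WeaklyHyperconnexive : Set₁
  WeaklyHyperconnexive = WeaklyConnexive × WCBT

  FullyHyperconnexive : Set₁
  FullyHyperconnexive = PlainlyHyperconnexive × WeaklyHyperconnexive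

{-# OPTIONS --safe #-}
module Submission where

-- Falsifying φ ⟶ ψ means verifying φ ⟶ ∼ ψ, so ∼ (φ ⟶ ψ) and φ ⟶ ∼ ψ hold at
-- the same worlds: AT, BT and CBT for ⟶ are instances of χ ⟶ χ, and for ⇒ they
-- follow because φ ⟶ ∼ ψ verifies ∼ (φ ⇒ ψ). Both connectives admit modus ponens,
-- so valid schemes yield their weak forms and failures by consequence yield
-- failures of validity. The failures needed all occur at a single world without
-- R-successors where only var 0 is verified and nothing is falsified: there
-- var 1 ⇒ var 0 and ∼ (var 0 ⇒ var 1) hold vacuously but var 0 ⟶ var 1 does not.
-- Negation inconsistency: (φ ∧ ∼ φ) ⟶ φ is verified and falsified everywhere.

open import Defs
open import Data.Empty using (⊥)
open import Data.Product using (_×_; _,_; proj₁; proj₂)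
open import Data.Sum using (inj₁; inj₂)
open import Data.Unit using (⊤; tt)
open import Function using (_∘_; id)
open import Relation.Nullary using (¬_)
open import Relation.Binary.PropositionalEquality using (_≡_; refl)

record Verified (φ : Form) : Set₁ where
  constructor mkVerified
  field at : (M : Model) (w : Model.W M) → _⊨⁺_ M w φ

infix 3 _⊆⁺_

record _⊆⁺_ (φ ψ : Form) : Set₁ where
  constructor mk⊆⁺
  field apply : (M : Model) (w : Model.W M) → _⊨⁺_ M w φ → _⊨⁺_ M w ψ

open Verified
open _⊆⁺_

Verified⇒Valid : ∀ {φ} → Verified φ → Valid φ
Verified⇒Valid φ-verified M w (_ , φ-refuted) = φ-refuted _ refl (φ-verified .at M w)

Valid⇒¬¬Verified : ∀ {φ} → Valid φ → (M : Model) (w : Model.W M) → ¬ ¬ _⊨⁺_ M w φ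
Valid⇒¬¬Verified φ-valid M w ¬φ = φ-valid M w ((λ _ ()) , λ { _ refl → ¬φ })

⊆⁺-refl : ∀ {φ} → φ ⊆⁺ φ
⊆⁺-refl = mk⊆⁺ λ _ _ → id

⊆⁺-trans : ∀ {φ ψ χ} → φ ⊆⁺ ψ → ψ ⊆⁺ χ → φ ⊆⁺ χ
⊆⁺-trans φ⊆ψ ψ⊆χ = mk⊆⁺ λ M w → ψ⊆χ .apply M w ∘ φ⊆ψ .apply M w

⊆⁺-Verified : ∀ {φ ψ} → φ ⊆⁺ ψ → Verified φ → Verified ψ
⊆⁺-Verified φ⊆ψ φ-verified = mkVerified λ M w → φ⊆ψ .apply M w (φ-verified .at M w)

⊆⁺⇒Verified-⟶ : ∀ {φ ψ} → φ ⊆⁺ ψ → Verified (φ ⟶ ψ)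
⊆⁺⇒Verified-⟶ φ⊆ψ = mkVerified λ M _ v _ → φ⊆ψ .apply M v

⊆⁺⇒Verified-⇒ : ∀ {φ ψ} → φ ⊆⁺ ψ → ∼ ψ ⊆⁺ ∼ φ → Verified (φ ⇒ ψ)
⊆⁺⇒Verified-⇒ φ⊆ψ ∼ψ⊆∼φ =
  mkVerified λ M w → ⊆⁺⇒Verified-⟶ φ⊆ψ .at M w , ⊆⁺⇒Verified-⟶ ∼ψ⊆∼φ .at M w

⇒-⊆⁺-⟶ : ∀ {φ ψ} → (φ ⇒ ψ) ⊆⁺ (φ ⟶ ψ)
⇒-⊆⁺-⟶ = mk⊆⁺ λ _ _ → proj₁

∼⟶-⊆⁺-⟶∼ : ∀ {φ ψ} → ∼ (φ ⟶ ψ) ⊆⁺ (φ ⟶ ∼ ψ)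
∼⟶-⊆⁺-⟶∼ = mk⊆⁺ λ _ _ → id

⟶∼-⊆⁺-∼⟶ : ∀ {φ ψ} → (φ ⟶ ∼ ψ) ⊆⁺ ∼ (φ ⟶ ψ)
⟶∼-⊆⁺-∼⟶ = mk⊆⁺ λ _ _ → id

⟶∼-⊆⁺-∼⇒ : ∀ {φ ψ} → (φ ⟶ ∼ ψ) ⊆⁺ ∼ (φ ⇒ ψ)
⟶∼-⊆⁺-∼⇒ = mk⊆⁺ λ _ _ → inj₁

Verified-∧∼ : ∀ φ → Verified (((φ ∧ ∼ φ) ⟶ φ) ∧ ∼ ((φ ∧ ∼ φ) ⟶ φ))
Verified-∧∼ φ = mkVerified λ _ _ → (λ _ _ → proj₁) , (λ _ _ → proj₂)

negInconsistent : NegInconsistent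
negInconsistent = _ , Verified⇒Valid (Verified-∧∼ (var 0))

¬⊨-by-countermodel : ∀ {φ ψ} (M : Model) (w : Model.W M) →
  _⊨⁺_ M w φ → ¬ _⊨⁺_ M w ψ → ¬ (｛ φ ｝ ⊨ ｛ ψ ｝)
¬⊨-by-countermodel M w φ-holds ψ-fails φ⊨ψ =
  φ⊨ψ M w ((λ { _ refl → φ-holds }) , λ { _ refl → ψ-fails })

Detachable : Conn → Set₁
Detachable _⋆_ = ∀ {φ ψ} → Valid (φ ⋆ ψ) → ｛ φ ｝ ⊨ ｛ ψ ｝

⊆⁺-⟶⇒Detachable : ∀ {_⋆_ : Conn} → (∀ {φ ψ} → (φ ⋆ ψ) ⊆⁺ (φ ⟶ ψ)) → Detachable _⋆_
⊆⁺-⟶⇒Detachable ⋆⊆⟶ φ⋆ψ-valid M w (φ-holds , ψ-fails) =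
  Valid⇒¬¬Verified φ⋆ψ-valid M w λ φ⋆ψ →
    ψ-fails _ refl (⋆⊆⟶ .apply M w φ⋆ψ w (Model.≤-refl M w) (φ-holds _ refl))

detachable-⟶ : Detachable _⟶_
detachable-⟶ = ⊆⁺-⟶⇒Detachable ⊆⁺-refl

detachable-⇒ : Detachable _⇒_
detachable-⇒ = ⊆⁺-⟶⇒Detachable ⇒-⊆⁺-⟶

module _ {_⋆_ : Conn} (detach : Detachable _⋆_) where

  BT⇒WBT : BT _⋆_ → WBT _⋆_
  BT⇒WBT bt φ ψ = detach (bt φ ψ)

  CBT⇒WCBT : CBT _⋆_ → WCBT _⋆_
  CBT⇒WCBT cbt φ ψ = detach (cbt φ ψ)

  WNonSymFails⇒NonSymFails : WNonSymFails _⋆_ → NonSymFails _⋆_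
  WNonSymFails⇒NonSymFails (φ , ψ , ¬φ⋆ψ⊨ψ⋆φ) = φ , ψ , ¬φ⋆ψ⊨ψ⋆φ ∘ detach

  fullyConnexive : AT _⋆_ → BT _⋆_ → WNonSymFails _⋆_ → FullyConnexive _⋆_
  fullyConnexive at bt wnonsym =
    (at , bt , WNonSymFails⇒NonSymFails wnonsym) , (at , BT⇒WBT bt , wnonsym)

  fullyHyperconnexive :
    AT _⋆_ → BT _⋆_ → CBT _⋆_ → WNonSymFails _⋆_ → FullyHyperconnexive _⋆_
  fullyHyperconnexive at bt cbt wnonsym =
    let (plain , weak) = fullyConnexive at bt wnonsym
    in (plain , cbt) , (weak , CBT⇒WCBT cbt)

  ¬WCBT⇒¬PlainlyHyperconnexive : ¬ WCBT _⋆_ → ¬ PlainlyHyperconnexive _⋆_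
  ¬WCBT⇒¬PlainlyHyperconnexive ¬wcbt = ¬wcbt ∘ CBT⇒WCBT ∘ proj₂

¬WCBT⇒¬WeaklyHyperconnexive : ∀ {_⋆_ : Conn} → ¬ WCBT _⋆_ → ¬ WeaklyHyperconnexive _⋆_
¬WCBT⇒¬WeaklyHyperconnexive ¬wcbt = ¬wcbt ∘ proj₂

AT-⟶ : AT _⟶_
AT-⟶ φ = Verified⇒Valid (⊆⁺-Verified ⟶∼-⊆⁺-∼⟶ (⊆⁺⇒Verified-⟶ (⊆⁺-refl {∼ φ})))

BT-⟶ : BT _⟶_
BT-⟶ φ ψ = Verified⇒Valid (⊆⁺⇒Verified-⟶ ⟶∼-⊆⁺-∼⟶)

CBT-⟶ : CBT _⟶_
CBT-⟶ φ ψ = Verified⇒Valid (⊆⁺⇒Verified-⟶ ∼⟶-⊆⁺-⟶∼)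

AT-⇒ : AT _⇒_
AT-⇒ φ = Verified⇒Valid (⊆⁺-Verified ⟶∼-⊆⁺-∼⇒ (⊆⁺⇒Verified-⟶ (⊆⁺-refl {∼ φ})))

-- ∼ ∼ χ is verified exactly where χ is, so the second inclusion is
-- ⇒-⊆⁺-⟶ followed by ⟶∼-⊆⁺-∼⇒ up to that identification.
BT-⇒ : BT _⇒_
BT-⇒ φ ψ = Verified⇒Valid (⊆⁺⇒Verified-⇒
  (⊆⁺-trans ⇒-⊆⁺-⟶ ⟶∼-⊆⁺-∼⇒)
  (mk⊆⁺ λ _ _ → inj₁ ∘ proj₁))

module Countermodel where

  M : Model
  M = record
    { W = ⊤ ; inhabited = tt
    ; _≤_ = λ _ _ → ⊤ ; ≤-refl = λ _ → tt ; ≤-trans = λ _ _ → tt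
    ; R = λ _ _ → ⊥
    ; V⁺ = λ n _ → n ≡ 0 ; V⁻ = λ _ _ → ⊥
    ; V⁺-up = λ _ _ → id ; V⁻-up = λ _ _ → id
    ; c1 = λ { _ () } ; c2 = λ { () _ } }

  infix 4 _⊩_

  _⊩_ : ⊤ → Form → Set
  _⊩_ = _⊨⁺_ M

  q p : Form
  q = var 0
  p = var 1

  ⊮p : ¬ tt ⊩ p
  ⊮p ()

  ⊮∼p : ¬ tt ⊩ ∼ p
  ⊮∼p ()

  ⊩p⟶q : tt ⊩ (p ⟶ q)
  ⊩p⟶q _ _ ()

  ⊩p⇒q : tt ⊩ (p ⇒ q)
  ⊩p⇒q = ⊩p⟶q , λ _ _ ()

  ⊮q⟶p : ¬ tt ⊩ (q ⟶ p)
  ⊮q⟶p q⟶p = ⊮p (q⟶p tt tt refl)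

  ⊩∼q⇒p : tt ⊩ ∼ (q ⇒ p)
  ⊩∼q⇒p = inj₂ λ _ _ ()

  ⊮q⇒∼p : ¬ tt ⊩ (q ⇒ (∼ p))
  ⊮q⇒∼p (q⟶∼p , _) = ⊮∼p (q⟶∼p tt tt refl)

  ¬Trivial : ¬ Trivial
  ¬Trivial trivial = trivial ∅ ∅ M tt ((λ _ ()) , (λ _ ()))

  WNonSymFails-⟶ : WNonSymFails _⟶_
  WNonSymFails-⟶ = p , q , ¬⊨-by-countermodel M tt ⊩p⟶q ⊮q⟶p

  WNonSymFails-⇒ : WNonSymFails _⇒_
  WNonSymFails-⇒ = p , q , ¬⊨-by-countermodel M tt ⊩p⇒q (⊮q⟶p ∘ proj₁)

  ¬WCBT-⇒ : ¬ WCBT _⇒_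
  ¬WCBT-⇒ wcbt = ¬⊨-by-countermodel M tt ⊩∼q⇒p ⊮q⇒∼p (wcbt q p)

open Countermodel using (¬Trivial; WNonSymFails-⟶; WNonSymFails-⇒; ¬WCBT-⇒)

corollary4p17 : ¬ Trivial × NegInconsistent × FullyHyperconnexive _⟶_ × FullyConnexive _⇒_ × ¬ PlainlyHyperconnexive _⇒_ × ¬ WeaklyHyperconnexive _⇒_
corollary4p17 =
    ¬Trivial
  , negInconsistent
  , fullyHyperconnexive detachable-⟶ AT-⟶ BT-⟶ CBT-⟶ WNonSymFails-⟶
  , fullyConnexive detachable-⇒ AT-⇒ BT-⇒ WNonSymFails-⇒
  , ¬WCBT⇒¬PlainlyHyperconnexive detachable-⇒ ¬WCBT-⇒
  , ¬WCBT⇒¬WeaklyHyperconnexive ¬WCBT-⇒
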